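{- Let $n\ge 2$, let $\sigma$ be a prefix normal word chain generator of length $n$, let $j\in[n-1]$, and let $\sigma'$ be obtained from $\sigma$ by swapping the entries at positions $j$ and $j+1$ (so $\sigma'[j]=\sigma[j+1]$, $\sigma'[j+1]=\sigma[j]$, and $\sigma'[k]=\sigma[k]$ otherwise). Suppose $\sigma[j] > \sigma[j+1]$, and let $w=c_\sigma[j]$. Call a factor $v=w[a..b]$ of $w$ admissible if (i) $a\le \sigma[j]\le b$ and $\sigma[j+1]\notin[a,b]$ (i.e. $v$ includes the index $\sigma[j]$ and does not include the index $\sigma[j+1]$), (ii) $\sigma[j+1] \leq |v| < \sigma[j]$, and (iii) $|v|_1 = |\mathrm{pref}_{|v|}(w)|_1$. Then $\sigma'$ is a prefix normal word chain generator if and only if no admissible factor $v$ of $w$ exists.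
   Context: Words are over $\{0,1\}$. For a word $w$, $|w|$ is its length, $|w|_1$ the number of $1$s, $\mathrm{pref}_k(w)$ the prefix of length $k$, and $w[a..b]$ the factor from position $a$ to position $b$. A word $w$ is prefix normal if every factor $v$ of $w$ satisfies $|v|_1 \le |\mathrm{pref}_{|v|}(w)|_1$. A permutation $\sigma$ of $[n]$ is written in one-line notation with $\sigma[i]=\sigma(i)$. Its word chain $c_\sigma=(c_\sigma[1],\dots,c_\sigma[n+1])$ consists of words of length $n$ with $c_\sigma[1]=1^n$ and $c_\sigma[i+1]$ obtained from $c_\sigma[i]$ by changing the letter at position $\sigma(i)$ from $1$ to $0$ ($i\in[n]$). The permutation $\sigma$ is a prefix normal word chain generator if all words $c_\sigma[i]$ are prefix normal. -}

module Defs where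

open import Data.Bool using (Bool; true; false; if_then_else_)
open import Data.Nat using (ℕ; zero; suc; _≤_; _<_; _∸_; _<?_)
open import Data.Fin using (Fin; toℕ; fromℕ<; _≟_)
open import Data.Fin.Permutation using (Permutation′; _⟨$⟩ʳ_; _∘ₚ_; transpose)
open import Data.List using (List; []; _∷_; _++_; take; drop; length; tabulate)
open import Data.Product using (Σ; _×_; ∃)
open import Relation.Binary.PropositionalEquality using (_≡_)
open import Relation.Nullary using (¬_; yes; no; does)

-- Words over {0,1}: lists of Booleans, with true = 1 and false = 0.
Word : Set
Word = List Bool

ones : Word → ℕ
ones []          = 0
ones (true ∷ w)  = suc (ones w)
ones (false ∷ w) = ones w

pref : ℕ → Word → Word
pref = take

IsFactor : Word → Word → Set
IsFactor v w = Σ Word λ u → Σ Word λ x → u ++ v ++ x ≡ w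

PrefixNormal : Word → Set
PrefixNormal w = ∀ v → IsFactor v w → ones v ≤ ones (pref (length v) w)

-- w[a..b] with 1-indexed inclusive positions a ≤ b
factor : ℕ → ℕ → Word → Word
factor a b w = take (suc b ∸ a) (drop (a ∸ 1) w)

-- Word chain, as functions on positions (Fin n, position p ↔ paper index toℕ p + 1).
-- chainF σ k is c_σ[k+1]: start from 1^n, and at step i (0-indexed) set the
-- letter at position σ(i) from 1 to 0.
chainF : ∀ {n} → Permutation′ n → ℕ → Fin n → Bool
chainF σ zero    p = true
chainF {n} σ (suc k) p with k <? n
... | yes k<n = if does (p ≟ (σ ⟨$⟩ʳ fromℕ< k<n)) then false else chainF σ k p
... | no  _   = chainF σ k p

-- c_σ[i] for i ∈ [1, n+1], as a word of length n
chain : ∀ {n} → Permutation′ n → ℕ → Word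
chain σ i = tabulate (chainF σ (i ∸ 1))

IsPNGenerator : ∀ {n} → Permutation′ n → Set
IsPNGenerator {n} σ = ∀ i → 1 ≤ i → i ≤ suc n → PrefixNormal (chain σ i)

-- 1-indexed value σ[j] of σ at position p (p : Fin n is paper index toℕ p + 1)
val : ∀ {n} → Permutation′ n → Fin n → ℕ
val σ p = suc (toℕ (σ ⟨$⟩ʳ p))

-- σ' : swap the entries of σ at positions p and q, i.e. σ'(x) = σ(τ(x)), τ = (p q)
swapAt : ∀ {n} → Permutation′ n → Fin n → Fin n → Permutation′ n
swapAt σ p q = transpose p q ∘ₚ σ

-- admissible factor v = w[a..b] (1-indexed a ≤ b) for w = c_σ[j],
-- where x = σ[j], y = σ[j+1] (1-indexed values)
Admissible : ℕ → ℕ → Word → ℕ → ℕ → Set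
Admissible x y w a b =
  1 ≤ a × a ≤ b × b ≤ length w
  × (a ≤ x × x ≤ b) × ¬ (a ≤ y × y ≤ b)
  × (y ≤ length (factor a b w) × length (factor a b w) < x)
  × ones (factor a b w) ≡ ones (pref (length (factor a b w)) w)

{-# OPTIONS --safe #-}
module Submission where

-- Write w = c_σ[j], x = σ[j] and y = σ[j+1]. Swapping σ[j] and σ[j+1] changes only the
-- word c_σ[j+1] of the chain, which becomes w with position y cleared instead of w with
-- position x cleared; so σ′ is a generator iff w with y cleared is prefix normal.
-- Clearing y leaves a factor v avoiding y unchanged, while the prefix of length |v| loses a
-- 1 when y ≤ |v|: this breaks prefix normality exactly when v is tight, i.e.
-- |v|_1 = |pref_{|v|}(w)|_1. A tight factor v avoiding y with y ≤ |v| that also avoids x,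
-- or that contains x with x ≤ |v|, already violates prefix normality of c_σ[j+2] (where
-- both x and y are cleared); the remaining tight factors are exactly the admissible ones.

open import Defs
open import Data.Bool using (Bool; true; false; if_then_else_)
open import Data.Nat hiding (_≟_)
open import Data.Nat.Properties hiding (_≟_)
import Data.Nat as ℕ
import Data.Fin as Fin
open import Data.Fin using (Fin; toℕ; fromℕ<; _≟_)
open import Data.Fin.Properties using (toℕ-injective; toℕ-fromℕ<; fromℕ<-toℕ; toℕ<n)
open import Data.Fin.Permutation using (Permutation′; _⟨$⟩ʳ_; _⟨$⟩ˡ_; inverseˡ; inverseʳ)
import Data.Fin.Permutation.Components as PC
open import Data.List using ([]; _∷_; _++_; take; drop; length; tabulate)
open import Data.List.Properties
  using (length-take; length-drop; take++drop≡id; length-++; length-++-≤ˡ; tabulate-cong)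
open import Data.Product using (Σ; ∃₂; _×_; _,_; proj₂)
open import Function using (_∘_)
open import Function.Bundles using (_⇔_; mk⇔)
open import Function.Construct.Composition using (_⇔-∘_)
open import Relation.Binary.PropositionalEquality
  using (_≡_; _≢_; refl; sym; trans; cong; cong₂; subst; module ≡-Reasoning)
open import Relation.Nullary using (¬_; Dec; yes; no; does; contradiction; _×-dec_)
open import Relation.Nullary.Decidable using (dec-true; dec-false; does-⇔)

-- Positions are 0-indexed: position p is the paper's index p + 1, and window s m w is the
-- factor w[s+1 .. s+m].

clear : ℕ → Word → Word
clear _       []      = []
clear zero    (_ ∷ w) = false ∷ w
clear (suc y) (c ∷ w) = c ∷ clear y w

letter : ℕ → Word → Bool
letter _       []      = false
letter zero    (c ∷ _) = c
letter (suc y) (_ ∷ w) = letter y w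

window : ℕ → ℕ → Word → Word
window s m w = take m (drop s w)

InWindow : ℕ → ℕ → ℕ → Set
InWindow s m y = s ≤ y × y < s + m

inWindow? : ∀ s m y → Dec (InWindow s m y)
inWindow? s m y = s ≤? y ×-dec y <? s + m

length-clear : ∀ y w → length (clear y w) ≡ length w
length-clear _       []      = refl
length-clear zero    (_ ∷ w) = refl
length-clear (suc y) (_ ∷ w) = cong suc (length-clear y w)

letter-clear-≢ : ∀ {x y} w → x ≢ y → letter y (clear x w) ≡ letter y w
letter-clear-≢ {_}     {_}     []      _   = refl
letter-clear-≢ {zero}  {zero}  (_ ∷ w) x≢y = contradiction refl x≢y
letter-clear-≢ {zero}  {suc y} (_ ∷ w) _   = refl
letter-clear-≢ {suc x} {zero}  (_ ∷ w) _   = refl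
letter-clear-≢ {suc x} {suc y} (_ ∷ w) x≢y = letter-clear-≢ w (x≢y ∘ cong suc)

length-window : ∀ s m w → s + m ≤ length w → length (window s m w) ≡ m
length-window s m w s+m≤ = begin
  length (take m (drop s w)) ≡⟨ length-take m (drop s w) ⟩
  m ⊓ length (drop s w)      ≡⟨ cong (m ⊓_) (length-drop s w) ⟩
  m ⊓ (length w ∸ s)         ≡⟨ m≤n⇒m⊓n≡m m≤∣w∣∸s ⟩
  m                          ∎
  where
  open ≡-Reasoning
  m≤∣w∣∸s : m ≤ length w ∸ s
  m≤∣w∣∸s = subst (_≤ length w ∸ s) (m+n∸m≡n s m) (∸-monoˡ-≤ s s+m≤)

window-++ : ∀ (u v x : Word) → window (length u) (length v) (u ++ v ++ x) ≡ v
window-++ (_ ∷ u) v       x = window-++ u v x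
window-++ []      []      x = refl
window-++ []      (c ∷ v) x = cong (c ∷_) (window-++ [] v x)

window-clear-∉ : ∀ s m y w → ¬ InWindow s m y → window s m (clear y w) ≡ window s m w
window-clear-∉ _       _       _       []      _  = refl
window-clear-∉ zero    zero    _       (_ ∷ w) _  = refl
window-clear-∉ zero    (suc m) zero    (_ ∷ w) y∉ = contradiction (z≤n , z<s) y∉
window-clear-∉ zero    (suc m) (suc y) (c ∷ w) y∉ =
  cong (c ∷_) (window-clear-∉ zero m y w (λ (_ , y<m) → y∉ (z≤n , s<s y<m)))
window-clear-∉ (suc s) m       zero    (_ ∷ w) _  = refl
window-clear-∉ (suc s) m       (suc y) (_ ∷ w) y∉ =
  window-clear-∉ s m y w (λ (s≤y , y<s+m) → y∉ (s≤s s≤y , s<s y<s+m))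

ones-window-clear-∈ : ∀ s m y w → letter y w ≡ true → InWindow s m y →
                      ones (window s m w) ≡ suc (ones (window s m (clear y w)))
ones-window-clear-∈ _       _       _       []           ()
ones-window-clear-∈ zero    zero    _       (_ ∷ w)      _  (_ , ())
ones-window-clear-∈ zero    (suc m) zero    (true ∷ w)   _  _ = refl
ones-window-clear-∈ zero    (suc m) zero    (false ∷ w)  ()
ones-window-clear-∈ zero    (suc m) (suc y) (true ∷ w)   wᵧ (_ , s<s y<m) =
  cong suc (ones-window-clear-∈ zero m y w wᵧ (z≤n , y<m))
ones-window-clear-∈ zero    (suc m) (suc y) (false ∷ w)  wᵧ (_ , s<s y<m) =
  ones-window-clear-∈ zero m y w wᵧ (z≤n , y<m)
ones-window-clear-∈ (suc s) m       zero    (_ ∷ w)      _  (() , _)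
ones-window-clear-∈ (suc s) m       (suc y) (_ ∷ w)      wᵧ (s≤s s≤y , s<s y<s+m) =
  ones-window-clear-∈ s m y w wᵧ (s≤y , y<s+m)

ones-window-clear-≤ : ∀ s m y w → ones (window s m (clear y w)) ≤ ones (window s m w)
ones-window-clear-≤ _       _       _       []          = ≤-refl
ones-window-clear-≤ zero    zero    _       (_ ∷ w)     = z≤n
ones-window-clear-≤ zero    (suc m) zero    (true ∷ w)  = n≤1+n _
ones-window-clear-≤ zero    (suc m) zero    (false ∷ w) = ≤-refl
ones-window-clear-≤ zero    (suc m) (suc y) (true ∷ w)  = s≤s (ones-window-clear-≤ zero m y w)
ones-window-clear-≤ zero    (suc m) (suc y) (false ∷ w) = ones-window-clear-≤ zero m y w
ones-window-clear-≤ (suc s) m       zero    (_ ∷ w)     = ≤-refl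
ones-window-clear-≤ (suc s) m       (suc y) (_ ∷ w)     = ones-window-clear-≤ s m y w

ones-window-≤-suc-clear : ∀ s m y w → ones (window s m w) ≤ suc (ones (window s m (clear y w)))
ones-window-≤-suc-clear _       _       _       []          = n≤1+n _
ones-window-≤-suc-clear zero    zero    _       (_ ∷ w)     = z≤n
ones-window-≤-suc-clear zero    (suc m) zero    (true ∷ w)  = ≤-refl
ones-window-≤-suc-clear zero    (suc m) zero    (false ∷ w) = n≤1+n _
ones-window-≤-suc-clear zero    (suc m) (suc y) (true ∷ w)  = s≤s (ones-window-≤-suc-clear zero m y w)
ones-window-≤-suc-clear zero    (suc m) (suc y) (false ∷ w) = ones-window-≤-suc-clear zero m y w
ones-window-≤-suc-clear (suc s) m       zero    (_ ∷ w)     = n≤1+n _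
ones-window-≤-suc-clear (suc s) m       (suc y) (_ ∷ w)     = ones-window-≤-suc-clear s m y w

PrefixNormal′ : Word → Set
PrefixNormal′ w = ∀ s m → s + m ≤ length w → ones (window s m w) ≤ ones (take m w)

prefixNormal⇒prefixNormal′ : ∀ {w} → PrefixNormal w → PrefixNormal′ w
prefixNormal⇒prefixNormal′ {w} pn s m s+m≤ =
  subst (λ k → ones (window s m w) ≤ ones (take k w)) (length-window s m w s+m≤)
    (pn (window s m w) (take s w , drop m (drop s w) , w≡))
  where
  w≡ : take s w ++ window s m w ++ drop m (drop s w) ≡ w
  w≡ = trans (cong (take s w ++_) (take++drop≡id m (drop s w))) (take++drop≡id s w)

prefixNormal′⇒prefixNormal : ∀ {w} → PrefixNormal′ w → PrefixNormal w
prefixNormal′⇒prefixNormal pn′ v (u , x , refl) =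
  subst (λ v′ → ones v′ ≤ ones (take (length v) (u ++ v ++ x))) (window-++ u v x)
    (pn′ (length u) (length v) ∣u∣+∣v∣≤)
  where
  open ≤-Reasoning
  ∣u∣+∣v∣≤ : length u + length v ≤ length (u ++ v ++ x)
  ∣u∣+∣v∣≤ = begin
    length u + length v        ≤⟨ +-monoʳ-≤ (length u) (length-++-≤ˡ v) ⟩
    length u + length (v ++ x) ≡⟨ length-++ u ⟨
    length (u ++ v ++ x)       ∎

AdmissibleWindow : ℕ → ℕ → Word → ℕ → ℕ → Set
AdmissibleWindow x y w s m =
  s + m ≤ length w × InWindow s m x × ¬ InWindow s m y × (y < m × m ≤ x)
  × ones (window s m w) ≡ ones (take m w)

module _ {x y : ℕ} {w : Word} where

  private
    factor-window : ∀ s m → factor (suc s) (s + m) w ≡ window s m w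
    factor-window s m = cong (λ k → take k (drop s w)) (m+n∸m≡n s m)

    length-factor : ∀ s m → s + m ≤ length w → length (factor (suc s) (s + m) w) ≡ m
    length-factor s m s+m≤ = trans (cong length (factor-window s m)) (length-window s m w s+m≤)

  admissibleWindow⇒admissible : ∀ {s m} → AdmissibleWindow x y w s m →
                                Admissible (suc x) (suc y) w (suc s) (s + m)
  admissibleWindow⇒admissible {s} {m} (s+m≤ , (s≤x , x<s+m) , y∉ , (y<m , m≤x) , tight) =
    s≤s z≤n , m<m+n s (≤-<-trans z≤n y<m) , s+m≤ , (s≤s s≤x , x<s+m)
    , (λ (s<y , y<s+m) → y∉ (s≤s⁻¹ s<y , y<s+m))
    , (subst (suc y ≤_) (sym ∣v∣≡m) y<m , subst (_< suc x) (sym ∣v∣≡m) (s≤s m≤x))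
    , (begin
        ones (factor (suc s) (s + m) w)                  ≡⟨ cong ones (factor-window s m) ⟩
        ones (window s m w)                              ≡⟨ tight ⟩
        ones (take m w)                                  ≡⟨ cong (λ k → ones (take k w)) ∣v∣≡m ⟨
        ones (take (length (factor (suc s) (s + m) w)) w) ∎)
    where
    open ≡-Reasoning
    ∣v∣≡m : length (factor (suc s) (s + m) w) ≡ m
    ∣v∣≡m = length-factor s m s+m≤

  admissible⇒admissibleWindow : ∀ {a b} → Admissible (suc x) (suc y) w a b →
                                ∃₂ (AdmissibleWindow x y w)
  admissible⇒admissibleWindow {suc s} {b} adm@(_ , a≤b , _) =
    s , b ∸ s , fromFactor (subst (Admissible (suc x) (suc y) w (suc s)) (sym s+[b∸s]≡b) adm)
    where
    s+[b∸s]≡b : s + (b ∸ s) ≡ b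
    s+[b∸s]≡b = m+[n∸m]≡n (≤-trans (n≤1+n s) a≤b)

    fromFactor : ∀ {m} → Admissible (suc x) (suc y) w (suc s) (s + m) →
                 AdmissibleWindow x y w s m
    fromFactor {m} (_ , _ , s+m≤ , (s<x , x<s+m) , y∉ , (y<∣v∣ , ∣v∣≤x) , tight) =
      s+m≤ , (s≤s⁻¹ s<x , x<s+m) , (λ (s≤y , y<s+m) → y∉ (s≤s s≤y , y<s+m))
      , (subst (suc y ≤_) ∣v∣≡m y<∣v∣ , s≤s⁻¹ (subst (_< suc x) ∣v∣≡m ∣v∣≤x))
      , (begin
          ones (window s m w)                              ≡⟨ cong ones (factor-window s m) ⟨
          ones (factor (suc s) (s + m) w)                  ≡⟨ tight ⟩
          ones (take (length (factor (suc s) (s + m) w)) w) ≡⟨ cong (λ k → ones (take k w)) ∣v∣≡m ⟩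
          ones (take m w)                                  ∎)
      where
      open ≡-Reasoning
      ∣v∣≡m : length (factor (suc s) (s + m) w) ≡ m
      ∣v∣≡m = length-factor s m s+m≤

clear-prefixNormal′⇒¬admissibleWindow : ∀ {x y w s m} → letter y w ≡ true →
  PrefixNormal′ (clear y w) → ¬ AdmissibleWindow x y w s m
clear-prefixNormal′⇒¬admissibleWindow {y = y} {w} {s} {m} wᵧ pn′
                                      (s+m≤ , _ , y∉ , (y<m , _) , tight) =
  <⇒≱ prefix<window (pn′ s m (subst (s + m ≤_) (sym (length-clear y w)) s+m≤))
  where
  open ≤-Reasoning
  prefix<window : ones (take m (clear y w)) < ones (window s m (clear y w))
  prefix<window = begin-strict
    ones (take m (clear y w))       <⟨ n<1+n _ ⟩
    suc (ones (take m (clear y w))) ≡⟨ ones-window-clear-∈ 0 m y w wᵧ (z≤n , y<m) ⟨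
    ones (take m w)                 ≡⟨ tight ⟨
    ones (window s m w)             ≡⟨ cong ones (window-clear-∉ s m y w y∉) ⟨
    ones (window s m (clear y w))   ∎

module _ {x y : ℕ} {w : Word} (x≢y : x ≢ y) (wₓ : letter x w ≡ true) (wᵧ : letter y w ≡ true)
         (pn : PrefixNormal′ w) (pn″ : PrefixNormal′ (clear y (clear x w))) where

  private
    w″ : Word
    w″ = clear y (clear x w)

    pn″-bound : ∀ s m → s + m ≤ length w → ones (window s m w″) ≤ ones (take m w″)
    pn″-bound s m =
      pn″ s m ∘ subst (s + m ≤_) (sym (trans (length-clear y (clear x w)) (length-clear x w)))

    ones-prefix-clear-y : ∀ {m} → y < m → ones (take m (clear x w)) ≡ suc (ones (take m w″))
    ones-prefix-clear-y y<m =
      ones-window-clear-∈ 0 _ y (clear x w) (trans (letter-clear-≢ w x≢y) wᵧ) (z≤n , y<m)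

  tight-window⇒admissibleWindow : ∀ {s m} → s + m ≤ length w → ¬ InWindow s m y → y < m →
    ones (window s m w) ≡ ones (take m w) → AdmissibleWindow x y w s m
  tight-window⇒admissibleWindow {s} {m} s+m≤ y∉ y<m tight with inWindow? s m x | m ≤? x
  ... | yes x∈ | yes m≤x = s+m≤ , x∈ , y∉ , (y<m , m≤x) , tight
  ... | yes x∈ | no m≰x =
    contradiction (pn″-bound s m s+m≤) (<⇒≱ (≤-reflexive (suc-injective 2+prefix″≡1+window″)))
    where
    open ≡-Reasoning
    2+prefix″≡1+window″ : suc (suc (ones (take m w″))) ≡ suc (ones (window s m w″))
    2+prefix″≡1+window″ = begin
      suc (suc (ones (take m w″)))        ≡⟨ cong suc (ones-prefix-clear-y y<m) ⟨
      suc (ones (take m (clear x w)))     ≡⟨ ones-window-clear-∈ 0 m x w wₓ (z≤n , ≰⇒> m≰x) ⟨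
      ones (take m w)                     ≡⟨ tight ⟨
      ones (window s m w)                 ≡⟨ ones-window-clear-∈ s m x w wₓ x∈ ⟩
      suc (ones (window s m (clear x w))) ≡⟨ cong (suc ∘ ones) (window-clear-∉ s m y _ y∉) ⟨
      suc (ones (window s m w″))          ∎
  ... | no x∉ | _ = contradiction (pn″-bound s m s+m≤) (<⇒≱ prefix″<window″)
    where
    open ≤-Reasoning
    prefix″<window″ : ones (take m w″) < ones (window s m w″)
    prefix″<window″ = begin-strict
      ones (take m w″)              <⟨ n<1+n _ ⟩
      suc (ones (take m w″))        ≡⟨ ones-prefix-clear-y y<m ⟨
      ones (take m (clear x w))     ≤⟨ ones-window-clear-≤ 0 m x w ⟩
      ones (take m w)               ≡⟨ tight ⟨
      ones (window s m w)           ≡⟨ cong ones (window-clear-∉ s m x w x∉) ⟨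
      ones (window s m (clear x w)) ≡⟨ cong ones (window-clear-∉ s m y (clear x w) y∉) ⟨
      ones (window s m w″)          ∎

  clear-window-bound-∈ : ∀ {s m} → s + m ≤ length w → InWindow s m y →
    ones (window s m (clear y w)) ≤ ones (take m (clear y w))
  clear-window-bound-∈ {s} {m} s+m≤ y∈ = s≤s⁻¹ (begin
    suc (ones (window s m (clear y w))) ≡⟨ ones-window-clear-∈ s m y w wᵧ y∈ ⟨
    ones (window s m w)                 ≤⟨ pn s m s+m≤ ⟩
    ones (take m w)                     ≤⟨ ones-window-≤-suc-clear 0 m y w ⟩
    suc (ones (take m (clear y w)))     ∎)
    where open ≤-Reasoning

  window-bound-∉ : (∀ {s m} → ¬ AdmissibleWindow x y w s m) → ∀ {s m} → s + m ≤ length w →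
    ¬ InWindow s m y → ones (window s m w) ≤ ones (take m (clear y w))
  window-bound-∉ noAdm {s} {m} s+m≤ y∉ with y <? m
  ... | no y≮m = begin
    ones (window s m w)       ≤⟨ pn s m s+m≤ ⟩
    ones (take m w)           ≡⟨ cong ones (window-clear-∉ 0 m y w (y≮m ∘ proj₂)) ⟨
    ones (take m (clear y w)) ∎
    where open ≤-Reasoning
  ... | yes y<m = s≤s⁻¹ (begin
    suc (ones (window s m w))       ≤⟨ window<prefix ⟩
    ones (take m w)                 ≡⟨ ones-window-clear-∈ 0 m y w wᵧ (z≤n , y<m) ⟩
    suc (ones (take m (clear y w))) ∎)
    where
    open ≤-Reasoning
    window<prefix : ones (window s m w) < ones (take m w)
    window<prefix = ≤∧≢⇒< (pn s m s+m≤) (noAdm ∘ tight-window⇒admissibleWindow s+m≤ y∉ y<m)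

  ¬admissibleWindow⇒clear-prefixNormal′ : (∀ {s m} → ¬ AdmissibleWindow x y w s m) →
                                          PrefixNormal′ (clear y w)
  ¬admissibleWindow⇒clear-prefixNormal′ noAdm s m s+m≤′
    with s+m≤ ← subst (s + m ≤_) (length-clear y w) s+m≤′ | inWindow? s m y
  ... | yes y∈ = clear-window-bound-∈ s+m≤ y∈
  ... | no y∉  = subst (_≤ ones (take m (clear y w)))
                       (cong ones (sym (window-clear-∉ s m y w y∉)))
                       (window-bound-∉ noAdm s+m≤ y∉)

clear-prefixNormal⇔¬admissible : ∀ {x y w} → x ≢ y → letter x w ≡ true → letter y w ≡ true →
  PrefixNormal w → PrefixNormal (clear y (clear x w)) →
  PrefixNormal (clear y w) ⇔ (¬ (Σ ℕ λ a → Σ ℕ λ b → Admissible (suc x) (suc y) w a b))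
clear-prefixNormal⇔¬admissible x≢y wₓ wᵧ pn pn″ = mk⇔
  (λ pn′ (_ , _ , adm) → let (_ , _ , aw) = admissible⇒admissibleWindow adm in
    clear-prefixNormal′⇒¬admissibleWindow wᵧ (prefixNormal⇒prefixNormal′ pn′) aw)
  (λ noAdm → prefixNormal′⇒prefixNormal
    (¬admissibleWindow⇒clear-prefixNormal′ x≢y wₓ wᵧ
      (prefixNormal⇒prefixNormal′ pn) (prefixNormal⇒prefixNormal′ pn″)
      (λ aw → noAdm (_ , _ , admissibleWindow⇒admissible aw))))

does-≤?≡does-<? : ∀ {k i} → k ≢ i → does (k ≤? i) ≡ does (k <? i)
does-≤?≡does-<? {k} {i} k≢i = does-⇔ (mk⇔ (λ k≤i → ≤∧≢⇒< k≤i k≢i) <⇒≤) (k ≤? i) (k <? i)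

does-≤?-suc : ∀ {k i} → k ≢ suc i → does (k ≤? i) ≡ does (k ≤? suc i)
does-≤?-suc {k} {i} k≢1+i =
  does-⇔ (mk⇔ m≤n⇒m≤1+n (λ k≤1+i → s≤s⁻¹ (≤∧≢⇒< k≤1+i k≢1+i))) (k ≤? i) (k ≤? suc i)

does-≤?-transpose : ∀ {n} {i i′ : Fin n} → toℕ i′ ≡ suc (toℕ i) → ∀ {k} → k ≢ suc (toℕ i) →
                    ∀ q → does (k ≤? toℕ (PC.transpose i′ i q)) ≡ does (k ≤? toℕ q)
does-≤?-transpose {i = i} {i′} i′≡1+i {k} k≢1+i q with q ≟ i′
... | yes refl = trans (does-≤?-suc k≢1+i) (cong (λ t → does (k ≤? t)) (sym i′≡1+i))
... | no _ with q ≟ i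
...   | yes refl = trans (cong (λ t → does (k ≤? t)) i′≡1+i) (sym (does-≤?-suc k≢1+i))
...   | no _ = refl

letter-tabulate : ∀ {n} (f : Fin n → Bool) q → letter (toℕ q) (tabulate f) ≡ f q
letter-tabulate f Fin.zero    = refl
letter-tabulate f (Fin.suc q) = letter-tabulate (f ∘ Fin.suc) q

tabulate-clear : ∀ {n} (f : Fin n → Bool) q →
                 tabulate (λ p → if does (p ≟ q) then false else f p) ≡ clear (toℕ q) (tabulate f)
tabulate-clear f Fin.zero    = refl
tabulate-clear f (Fin.suc q) = cong (f Fin.zero ∷_) (tabulate-clear (f ∘ Fin.suc) q)

module _ {n : ℕ} (σ : Permutation′ n) where

  chainF-inverse : ∀ k p → chainF σ k p ≡ does (k ≤? toℕ (σ ⟨$⟩ˡ p))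
  chainF-inverse zero    p = refl
  chainF-inverse (suc k) p with k <? n
  ... | no k≮n = trans (chainF-inverse k p) (does-≤?≡does-<? k≢σ⁻¹p)
    where
    k≢σ⁻¹p : k ≢ toℕ (σ ⟨$⟩ˡ p)
    k≢σ⁻¹p refl = k≮n (toℕ<n (σ ⟨$⟩ˡ p))
  ... | yes k<n with p ≟ σ ⟨$⟩ʳ fromℕ< k<n
  ...   | yes refl rewrite inverseˡ σ {fromℕ< k<n} | toℕ-fromℕ< k<n =
    sym (dec-false (suc k ≤? k) (n≮n k))
  ...   | no p≢σk = trans (chainF-inverse k p) (does-≤?≡does-<? k≢σ⁻¹p)
    where
    k≢σ⁻¹p : k ≢ toℕ (σ ⟨$⟩ˡ p)
    k≢σ⁻¹p k≡ = p≢σk (trans (sym (inverseʳ σ))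
                     (cong (σ ⟨$⟩ʳ_) (toℕ-injective (trans (sym k≡) (sym (toℕ-fromℕ< k<n))))))

  chainF-suc : ∀ q p →
    chainF σ (suc (toℕ q)) p ≡ (if does (p ≟ σ ⟨$⟩ʳ q) then false else chainF σ (toℕ q) p)
  chainF-suc q p with toℕ q <? n
  ... | yes q<n rewrite fromℕ<-toℕ q q<n = refl
  ... | no q≮n = contradiction (toℕ<n q) q≮n

  letter-chain : ∀ {k} q → k ≤ toℕ q → letter (toℕ (σ ⟨$⟩ʳ q)) (chain σ (suc k)) ≡ true
  letter-chain {k} q k≤q = begin
    letter (toℕ (σ ⟨$⟩ʳ q)) (tabulate (chainF σ k)) ≡⟨ letter-tabulate (chainF σ k) (σ ⟨$⟩ʳ q) ⟩
    chainF σ k (σ ⟨$⟩ʳ q)                            ≡⟨ chainF-inverse k (σ ⟨$⟩ʳ q) ⟩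
    does (k ≤? toℕ (σ ⟨$⟩ˡ (σ ⟨$⟩ʳ q)))               ≡⟨ cong (λ t → does (k ≤? toℕ t)) (inverseˡ σ) ⟩
    does (k ≤? toℕ q)                                ≡⟨ dec-true (k ≤? toℕ q) k≤q ⟩
    true                                             ∎
    where open ≡-Reasoning

  chain-suc : ∀ {k} q → toℕ q ≡ k →
    chain σ (suc (suc k)) ≡ clear (toℕ (σ ⟨$⟩ʳ q)) (chain σ (suc k))
  chain-suc q refl =
    trans (tabulate-cong (chainF-suc q)) (tabulate-clear (chainF σ (toℕ q)) (σ ⟨$⟩ʳ q))

module _ {n : ℕ} (σ : Permutation′ n) {j j′ : Fin n} (j′≡1+j : toℕ j′ ≡ suc (toℕ j)) where

  private
    σ′ : Permutation′ n
    σ′ = swapAt σ j j′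

    J : ℕ
    J = toℕ j

  chainF-swapAt : ∀ {k} → k ≢ suc J → ∀ p → chainF σ′ k p ≡ chainF σ k p
  chainF-swapAt {k} k≢1+J p = begin
    chainF σ′ k p                                  ≡⟨ chainF-inverse σ′ k p ⟩
    does (k ≤? toℕ (PC.transpose j′ j (σ ⟨$⟩ˡ p))) ≡⟨ does-≤?-transpose j′≡1+j k≢1+J (σ ⟨$⟩ˡ p) ⟩
    does (k ≤? toℕ (σ ⟨$⟩ˡ p))                     ≡⟨ chainF-inverse σ k p ⟨
    chainF σ k p                                   ∎
    where open ≡-Reasoning

  chain-swapAt-≢ : ∀ {i} → i ≢ suc (suc J) → chain σ′ i ≡ chain σ i
  chain-swapAt-≢ {zero}  _      = refl
  chain-swapAt-≢ {suc i} i≢2+J = tabulate-cong (chainF-swapAt (i≢2+J ∘ cong suc))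

  chain-swapAt : chain σ′ (suc (suc J)) ≡ clear (toℕ (σ ⟨$⟩ʳ j′)) (chain σ (suc J))
  chain-swapAt = begin
    chain σ′ (suc (suc J))                      ≡⟨ chain-suc σ′ j refl ⟩
    clear (toℕ (σ′ ⟨$⟩ʳ j)) (chain σ′ (suc J))  ≡⟨ cong₂ (λ q → clear (toℕ (σ ⟨$⟩ʳ q))) transpose-j≡j′
                                                          (chain-swapAt-≢ (<⇒≢ (n<1+n (suc J)))) ⟩
    clear (toℕ (σ ⟨$⟩ʳ j′)) (chain σ (suc J))   ∎
    where
    open ≡-Reasoning
    transpose-j≡j′ : PC.transpose j j′ j ≡ j′
    transpose-j≡j′ rewrite dec-true (j ≟ j) refl = refl

  chain-suc-suc : chain σ (suc (suc (suc J))) ≡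
                  clear (toℕ (σ ⟨$⟩ʳ j′)) (clear (toℕ (σ ⟨$⟩ʳ j)) (chain σ (suc J)))
  chain-suc-suc = trans (chain-suc σ j′ j′≡1+j) (cong (clear _) (chain-suc σ j refl))

  2+J≤n : suc (suc J) ≤ n
  2+J≤n = subst (_< n) j′≡1+j (toℕ<n j′)

  isPNGenerator-swapAt⇔ : IsPNGenerator σ →
    IsPNGenerator σ′ ⇔ PrefixNormal (clear (toℕ (σ ⟨$⟩ʳ j′)) (chain σ (suc J)))
  isPNGenerator-swapAt⇔ gen = mk⇔
    (λ gen′ → subst PrefixNormal chain-swapAt (gen′ (suc (suc J)) (s≤s z≤n) (m≤n⇒m≤1+n 2+J≤n)))
    fromClear
    where
    fromClear : PrefixNormal (clear (toℕ (σ ⟨$⟩ʳ j′)) (chain σ (suc J))) → IsPNGenerator σ′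
    fromClear pn i 1≤i i≤1+n with i ℕ.≟ suc (suc J)
    ... | yes refl = subst PrefixNormal (sym chain-swapAt) pn
    ... | no i≢2+J = subst PrefixNormal (sym (chain-swapAt-≢ i≢2+J)) (gen i 1≤i i≤1+n)

mainTheorem4 : (n : ℕ) → 2 ≤ n → (σ : Permutation′ n) → IsPNGenerator σ
    → (j j′ : Fin n) → toℕ j′ ≡ suc (toℕ j)
    → val σ j > val σ j′
    → (IsPNGenerator (swapAt σ j j′)
    ⇔ (¬ (Σ ℕ λ a → Σ ℕ λ b → Admissible (val σ j) (val σ j′) (chain σ (suc (toℕ j))) a b)))
mainTheorem4 n _ σ gen j j′ j′≡1+j σj>σj′ =
  clear-prefixNormal⇔¬admissible x≢y
    (letter-chain σ j ≤-refl) (letter-chain σ j′ (subst (toℕ j ≤_) (sym j′≡1+j) (n≤1+n _)))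
    (gen (suc (toℕ j)) (s≤s z≤n) (≤-trans (n≤1+n _) (m≤n⇒m≤1+n 2+j≤n)))
    (subst PrefixNormal (chain-suc-suc σ j′≡1+j)
      (gen (suc (suc (suc (toℕ j)))) (s≤s z≤n) (s≤s 2+j≤n)))
  ⇔-∘ isPNGenerator-swapAt⇔ σ j′≡1+j gen
  where
  2+j≤n : suc (suc (toℕ j)) ≤ n
  2+j≤n = 2+J≤n σ j′≡1+j
  x≢y : toℕ (σ ⟨$⟩ʳ j) ≢ toℕ (σ ⟨$⟩ʳ j′)
  x≢y = >⇒≢ (s≤s⁻¹ σj>σj′)
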